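{- Let $0\le t<k$ be integers and $n\ge k+t+1$. Then $t+2\le d_{t,n,k}\le 2^{t+1}$.
   Context: Let $N$ be an $n$-element set of points. A binary $t$-$(n,k)$-design is a nonempty set $D$ of $k$-element subsets of $N$ (blocks; no repeated blocks) such that every $t$-element subset of $N$ is contained in an even number of blocks of $D$ (for $t=0$: $|D|$ is even). $d_{t,n,k}$ denotes the minimum number of blocks of a binary $t$-$(n,k)$-design, equivalently the minimum distance of the binary linear code whose parity-check matrix is the inclusion matrix of $t$-subsets versus $k$-subsets of an $n$-set. -}

module Defs where

open import Data.Nat using (ℕ; _≡ᵇ_; _≤_)
open import Data.Nat.Divisibility using (_∣_)
open import Data.Fin.Subset using (Subset; ∣_∣; _⊆_)
open import Data.Fin.Subset.Properties using (_⊆?_)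
open import Data.List using (List; []; _∷_; length; filter)
open import Data.List.Relation.Unary.All using (All)
open import Data.List.Relation.Unary.Unique.Propositional using (Unique)
open import Data.Product using (_×_; Σ)
open import Relation.Binary.PropositionalEquality using (_≡_; _≢_)

blocksContaining : {n : ℕ} → Subset n → List (Subset n) → ℕ
blocksContaining T D = length (filter (T ⊆?_) D)

record IsBinaryDesign (t n k : ℕ) (D : List (Subset n)) : Set where
  field
    nonempty   : D ≢ []
    distinct   : Unique D
    blockSize  : All (λ B → ∣ B ∣ ≡ k) D
    evenCover  : (T : Subset n) → ∣ T ∣ ≡ t → 2 ∣ blocksContaining T D

-- "a ≤ d_{t,n,k} ≤ b", unfolding the definition of the minimum:
-- every design has at least a blocks, and some design has at most b blocks.
MinDesignSizeBetween : (t n k a b : ℕ) → Set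
MinDesignSizeBetween t n k a b =
  ((D : List (Subset n)) → IsBinaryDesign t n k D → a ≤ length D)
  × Σ (List (Subset n)) (λ D → IsBinaryDesign t n k D × length D ≤ b)

-- Lower bound: were B, C₁, …, Cₘ (m ≤ t) all the blocks, then B ⊈ Cᵢ, as distinct blocks of equal
-- size are incomparable; so B holds a point outside each Cᵢ, and these at most t points extend inside
-- B to a t-set lying in B alone, i.e. in an odd number of blocks.
-- Upper bound: on t + 1 disjoint pairs, every set of at most t points lies in an even number of the
-- 2^(t+1) transversals: in none if it contains a whole pair, and otherwise it misses some pair, on
-- which switching the choice matches up the transversals containing it.  Adding k - t - 1 points to
-- every block and n - k - t - 1 points to no block gives a binary t-(n,k) design.
module Submission where

open import Defs
open import Data.Nat using (ℕ; zero; suc; _+_; _*_; _^_; _≤_; _<_; z≤n; s≤s; _<?_)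
open import Data.Nat.Properties
open import Data.Nat.Divisibility using (_∣_; _∣0; >⇒∤; m∣m*n)
open import Data.Nat.Tactic.RingSolver using (solve-∀)
open import Data.Fin.Properties using (¬∀⟶∃¬)
open import Data.Fin.Subset
open import Data.Fin.Subset.Properties
open import Data.Vec using ([]; _∷_; here)
open import Data.Vec.Properties using (∷-injectiveʳ)
open import Data.List using (List; []; _∷_; _++_; length; filter; map)
open import Data.List.Properties using (length-++; length-map; filter-accept; filter-none; filter-++)
open import Data.List.Relation.Unary.All as All using (All; []; _∷_)
open import Data.List.Relation.Unary.AllPairs using ([]; _∷_)
open import Data.List.Relation.Unary.Unique.Propositional using (Unique)
import Data.List.Relation.Unary.All.Properties as All
import Data.List.Relation.Unary.Unique.Propositional.Properties as Unique
import Data.List.Membership.Propositional as List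
open import Data.List.Membership.Propositional.Properties using (∈-map⁻)
open import Data.Sum using (inj₁; inj₂)
open import Data.Product using (∃; _×_; _,_)
open import Function using (_⇔_; case_of_)
open import Function.Bundles using (module Equivalence)
open import Data.Empty using (⊥-elim)
open import Relation.Nullary using (¬_; yes; no; contradiction)
open import Relation.Nullary.Decidable using (_→-dec_)
open import Relation.Binary.PropositionalEquality

private
  variable
    n m j k : ℕ
    p q r T T′ B : Subset n
    D : List (Subset n)

∣p∪q∣≤∣p∣+∣q∣ : (p q : Subset n) → ∣ p ∪ q ∣ ≤ ∣ p ∣ + ∣ q ∣
∣p∪q∣≤∣p∣+∣q∣ []            []            = z≤n
∣p∪q∣≤∣p∣+∣q∣ (outside ∷ p) (outside ∷ q) = ∣p∪q∣≤∣p∣+∣q∣ p q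
∣p∪q∣≤∣p∣+∣q∣ (inside  ∷ p) (outside ∷ q) = s≤s (∣p∪q∣≤∣p∣+∣q∣ p q)
∣p∪q∣≤∣p∣+∣q∣ (outside ∷ p) (inside  ∷ q) =
  subst (∣ p ∪ q ∣ <_) (sym (+-suc ∣ p ∣ ∣ q ∣)) (s≤s (∣p∪q∣≤∣p∣+∣q∣ p q))
∣p∪q∣≤∣p∣+∣q∣ (inside  ∷ p) (inside  ∷ q) =
  s≤s (≤-trans (∣p∪q∣≤∣p∣+∣q∣ p q) (+-monoʳ-≤ ∣ p ∣ (n≤1+n ∣ q ∣)))

∪-least : p ⊆ r → q ⊆ r → p ∪ q ⊆ r
∪-least {p = p} {q = q} p⊆r q⊆r x∈p∪q with x∈p∪q⁻ p q x∈p∪q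
... | inj₁ x∈p = p⊆r x∈p
... | inj₂ x∈q = q⊆r x∈q

p⊆q⇒∣q∣≤∣p∣⇒p≡q : p ⊆ q → ∣ q ∣ ≤ ∣ p ∣ → p ≡ q
p⊆q⇒∣q∣≤∣p∣⇒p≡q {p = []}          {[]}          _   _ = refl
p⊆q⇒∣q∣≤∣p∣⇒p≡q {p = outside ∷ p} {outside ∷ q} p⊆q ∣q∣≤∣p∣ =
  cong (outside ∷_) (p⊆q⇒∣q∣≤∣p∣⇒p≡q (drop-∷-⊆ p⊆q) ∣q∣≤∣p∣)
p⊆q⇒∣q∣≤∣p∣⇒p≡q {p = inside  ∷ p} {inside  ∷ q} p⊆q ∣q∣≤∣p∣ =
  cong (inside ∷_) (p⊆q⇒∣q∣≤∣p∣⇒p≡q (drop-∷-⊆ p⊆q) (≤-pred ∣q∣≤∣p∣))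
p⊆q⇒∣q∣≤∣p∣⇒p≡q {p = outside ∷ p} {inside  ∷ q} p⊆q ∣q∣≤∣p∣ =
  contradiction ∣q∣≤∣p∣ (<⇒≱ (s≤s (p⊆q⇒∣p∣≤∣q∣ (drop-∷-⊆ p⊆q))))
p⊆q⇒∣q∣≤∣p∣⇒p≡q {p = inside  ∷ p} {outside ∷ q} p⊆q _ = contradiction (p⊆q here) λ ()

⊈⇒∃∈∉ : p ⊈ q → ∃ λ x → x ∈ p × x ∉ q
⊈⇒∃∈∉ {n} {p} {q} p⊈q with ¬∀⟶∃¬ n (λ x → x ∈ p → x ∈ q) (λ x → x ∈? p →-dec x ∈? q) (λ p⊆q → p⊈q (p⊆q _))
... | x , x∈p↛x∈q with x ∈? p
...   | yes x∈p = x , x∈p , λ x∈q → x∈p↛x∈q λ _ → x∈q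
...   | no  x∉p = contradiction (λ x∈p → contradiction x∈p x∉p) x∈p↛x∈q

⊆-interpolate : p ⊆ q → ∣ p ∣ ≤ m → m ≤ ∣ q ∣ → ∃ λ r → p ⊆ r × r ⊆ q × ∣ r ∣ ≡ m
⊆-interpolate {p = []} {[]} _ _ m≤0 = [] , ⊆-refl , ⊆-refl , sym (n≤0⇒n≡0 m≤0)
⊆-interpolate {p = outside ∷ p} {outside ∷ q} p⊆q ∣p∣≤m m≤∣q∣
  with r , p⊆r , r⊆q , ∣r∣≡m ← ⊆-interpolate (drop-∷-⊆ p⊆q) ∣p∣≤m m≤∣q∣
  = outside ∷ r , s⊆s p⊆r , s⊆s r⊆q , ∣r∣≡m
⊆-interpolate {p = inside ∷ p} {inside ∷ q} p⊆q (s≤s ∣p∣≤m) (s≤s m≤∣q∣)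
  with r , p⊆r , r⊆q , ∣r∣≡m ← ⊆-interpolate (drop-∷-⊆ p⊆q) ∣p∣≤m m≤∣q∣
  = inside ∷ r , s⊆s p⊆r , s⊆s r⊆q , cong suc ∣r∣≡m
⊆-interpolate {p = outside ∷ p} {inside ∷ q} {m} p⊆q ∣p∣≤m m≤1+∣q∣ with m ≤? ∣ q ∣
... | yes m≤∣q∣ with r , p⊆r , r⊆q , ∣r∣≡m ← ⊆-interpolate (drop-∷-⊆ p⊆q) ∣p∣≤m m≤∣q∣
  = outside ∷ r , s⊆s p⊆r , out⊆ r⊆q , ∣r∣≡m
... | no  m≰∣q∣ = inside ∷ q , out⊆ (drop-∷-⊆ p⊆q) , ⊆-refl , ≤-antisym (≰⇒> m≰∣q∣) m≤1+∣q∣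
⊆-interpolate {p = inside ∷ p} {outside ∷ q} p⊆q _ _ = contradiction (p⊆q here) λ ()

⊈-respˡ-⊇ : p ⊆ q → p ⊈ r → q ⊈ r
⊈-respˡ-⊇ p⊆q p⊈r q⊆r = p⊈r (⊆-trans p⊆q q⊆r)

separating-subset : (Cs : List (Subset n)) → All (p ⊈_) Cs →
  ∃ λ w → w ⊆ p × ∣ w ∣ ≤ length Cs × All (w ⊈_) Cs
separating-subset {n} []       []           = ⊥ , ⊥⊆ , ≤-reflexive (∣⊥∣≡0 n) , []
separating-subset {p = p} (C ∷ Cs) (p⊈C ∷ p⊈Cs)
  with x , x∈p , x∉C ← ⊈⇒∃∈∉ p⊈C
     | w , w⊆p , ∣w∣≤ , w⊈Cs ← separating-subset Cs p⊈Cs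
  = ⁅ x ⁆ ∪ w
  , ∪-least ⁅x⁆⊆p w⊆p
  , ≤-trans (∣p∪q∣≤∣p∣+∣q∣ ⁅ x ⁆ w) (+-mono-≤ (≤-reflexive (∣⁅x⁆∣≡1 x)) ∣w∣≤)
  , ⊈-respˡ-⊇ (p⊆p∪q w) (λ ⁅x⁆⊆C → x∉C (⁅x⁆⊆C (x∈⁅x⁆ x)))
  ∷ All.map (⊈-respˡ-⊇ (q⊆p∪q ⁅ x ⁆ w)) w⊈Cs
  where
  ⁅x⁆⊆p : ⁅ x ⁆ ⊆ p
  ⁅x⁆⊆p y∈⁅x⁆ = subst (_∈ p) (sym (x∈⁅y⁆⇒x≡y x y∈⁅x⁆)) x∈p

2∤1 : ¬ 2 ∣ 1
2∤1 = >⇒∤ (n<1+n 1)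

blocksContaining-single : T ⊆ B → All (T ⊈_) D → blocksContaining T (B ∷ D) ≡ 1
blocksContaining-single {T = T} T⊆B T⊈D =
  cong length (trans (filter-accept (T ⊆?_) T⊆B) (cong (_ ∷_) (filter-none (T ⊆?_) T⊈D)))

distinct-equal-size⇒⊈ : ∣ p ∣ ≡ ∣ q ∣ → p ≢ q → p ⊈ q
distinct-equal-size⇒⊈ ∣p∣≡∣q∣ p≢q p⊆q = p≢q (p⊆q⇒∣q∣≤∣p∣⇒p≡q p⊆q (≤-reflexive (sym ∣p∣≡∣q∣)))

singly-covered-subset : ∀ {t} (Cs : List (Subset n)) → All (B ⊈_) Cs → length Cs ≤ t → t ≤ ∣ B ∣ →
  ∃ λ T → ∣ T ∣ ≡ t × blocksContaining T (B ∷ Cs) ≡ 1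
singly-covered-subset Cs B⊈Cs ∣Cs∣≤t t≤∣B∣
  with w , w⊆B , ∣w∣≤∣Cs∣ , w⊈Cs ← separating-subset Cs B⊈Cs
  with T , w⊆T , T⊆B , ∣T∣≡t ← ⊆-interpolate w⊆B (≤-trans ∣w∣≤∣Cs∣ ∣Cs∣≤t) t≤∣B∣
  = T , ∣T∣≡t , blocksContaining-single T⊆B (All.map (⊈-respˡ-⊇ w⊆T) w⊈Cs)

equal-size-blocks-⊈ : Unique (B ∷ D) → All (λ C → ∣ C ∣ ≡ k) (B ∷ D) → All (B ⊈_) D
equal-size-blocks-⊈ (B≢D ∷ _) (∣B∣≡k ∷ ∣D∣≡k) =
  All.zipWith (λ (B≢C , ∣C∣≡k) → distinct-equal-size⇒⊈ (trans ∣B∣≡k (sym ∣C∣≡k)) B≢C) (B≢D , ∣D∣≡k)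

design-size-lower : ∀ {t} → t < k → IsBinaryDesign t n k D → t + 2 ≤ length D
design-size-lower {D = []} _ isD = contradiction refl (IsBinaryDesign.nonempty isD)
design-size-lower {D = B ∷ Cs} {t} t<k
  record { distinct = distinct ; blockSize = blockSize@(∣B∣≡k ∷ _) ; evenCover = evenCover }
  with t <? length Cs
... | yes t<∣Cs∣ = subst (_≤ suc (length Cs)) (+-comm 2 t) (s≤s t<∣Cs∣)
... | no  t≮∣Cs∣
  with T , ∣T∣≡t , single ← singly-covered-subset Cs (equal-size-blocks-⊈ distinct blockSize)
                                (≮⇒≥ t≮∣Cs∣) (subst (t ≤_) (sym ∣B∣≡k) (<⇒≤ t<k))
  = contradiction (subst (2 ∣_) single (evenCover T ∣T∣≡t)) 2∤1

blocksContaining-map : (f : Subset m → Subset n) → (∀ B → T ⊆ B ⇔ T′ ⊆ f B) →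
  (D : List (Subset m)) → blocksContaining T′ (map f D) ≡ blocksContaining T D
blocksContaining-map f T⊆B⇔T′⊆fB [] = refl
blocksContaining-map {T = T} {T′ = T′} f T⊆B⇔T′⊆fB (B ∷ D) with T ⊆? B | T′ ⊆? f B
... | yes _    | yes _     = cong suc (blocksContaining-map f T⊆B⇔T′⊆fB D)
... | no  _    | no  _     = blocksContaining-map f T⊆B⇔T′⊆fB D
... | yes T⊆B  | no  T′⊈fB = ⊥-elim (T′⊈fB (Equivalence.to (T⊆B⇔T′⊆fB B) T⊆B))
... | no  T⊈B  | yes T′⊆fB = ⊥-elim (T⊈B (Equivalence.from (T⊆B⇔T′⊆fB B) T′⊆fB))

blocksContaining-map-none : (f : Subset m → Subset n) → (∀ B → T′ ⊈ f B) →
  (D : List (Subset m)) → blocksContaining T′ (map f D) ≡ 0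
blocksContaining-map-none {T′ = T′} f T′⊈f D =
  cong length (filter-none (T′ ⊆?_) (All.map⁺ (All.universal T′⊈f D)))

blocksContaining-++ : (T : Subset n) (D E : List (Subset n)) →
  blocksContaining T (D ++ E) ≡ blocksContaining T D + blocksContaining T E
blocksContaining-++ T D E = trans (cong length (filter-++ (T ⊆?_) D E)) (length-++ (filter (T ⊆?_) D))

2∣m+m : ∀ m → 2 ∣ m + m
2∣m+m m = subst (2 ∣_) (cong (m +_) (+-identityʳ m)) (m∣m*n m)

record IsBinaryDesignBelow (j n k : ℕ) (D : List (Subset n)) : Set where
  field
    distinct  : Unique D
    blockSize : All (λ B → ∣ B ∣ ≡ k) D
    evenCover : (T : Subset n) → ∣ T ∣ < j → 2 ∣ blocksContaining T D

addApex : List (Subset n) → List (Subset (suc n))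
addApex = map (inside ∷_)

addIsolated : List (Subset n) → List (Subset (suc n))
addIsolated = map (outside ∷_)

blocksContaining-addApex : ∀ x (T : Subset n) D → blocksContaining (x ∷ T) (addApex D) ≡ blocksContaining T D
blocksContaining-addApex outside T = blocksContaining-map _ (λ _ → out⊆-⇔)
blocksContaining-addApex inside  T = blocksContaining-map _ (λ _ → in⊆in-⇔)

blocksContaining-addIsolated-outside : (T : Subset n) (D : List (Subset n)) →
  blocksContaining (outside ∷ T) (addIsolated D) ≡ blocksContaining T D
blocksContaining-addIsolated-outside T = blocksContaining-map _ (λ _ → out⊆-⇔)

blocksContaining-addIsolated-inside : (T : Subset n) (D : List (Subset n)) →
  blocksContaining (inside ∷ T) (addIsolated D) ≡ 0
blocksContaining-addIsolated-inside T = blocksContaining-map-none _ (λ _ ⊆outside → case ⊆outside here of λ ())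

addApex-design : IsBinaryDesignBelow j n k D → IsBinaryDesignBelow j (suc n) (suc k) (addApex D)
addApex-design {D = D} isD = record
  { distinct  = Unique.map⁺ ∷-injectiveʳ distinct
  ; blockSize = All.map⁺ (All.map (cong suc) blockSize)
  ; evenCover = λ { (x ∷ T) ∣xT∣<j → subst (2 ∣_) (sym (blocksContaining-addApex x T D))
                                       (evenCover T (≤-<-trans (∣p∣≤∣x∷p∣ x T) ∣xT∣<j)) }
  }
  where open IsBinaryDesignBelow isD

addIsolated-design : IsBinaryDesignBelow j n k D → IsBinaryDesignBelow j (suc n) k (addIsolated D)
addIsolated-design {D = D} isD = record
  { distinct  = Unique.map⁺ ∷-injectiveʳ distinct
  ; blockSize = All.map⁺ blockSize
  ; evenCover = λ
      { (outside ∷ T) ∣T∣<j → subst (2 ∣_) (sym (blocksContaining-addIsolated-outside T D)) (evenCover T ∣T∣<j)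
      ; (inside  ∷ T) _     → subst (2 ∣_) (sym (blocksContaining-addIsolated-inside T D)) (2 ∣0)
      }
  }
  where open IsBinaryDesignBelow isD

pairUp : List (Subset n) → List (Subset (suc (suc n)))
pairUp D = addApex (addIsolated D) ++ addIsolated (addApex D)

-- A set avoiding the new pair is counted equally often by both halves; one meeting it in a single
-- point is counted by one half only, as often as its trace on the old points, which is smaller.
pairUp-evenCover : ((T : Subset n) → ∣ T ∣ < j → 2 ∣ blocksContaining T D) →
  (T : Subset (suc (suc n))) → ∣ T ∣ < suc j → 2 ∣ blocksContaining T (pairUp D)
pairUp-evenCover {j = j} {D = D} evenCover (x ∷ y ∷ T) ∣xyT∣<1+j =
  subst (2 ∣_) (sym (blocksContaining-++ (x ∷ y ∷ T) (addApex (addIsolated D)) (addIsolated (addApex D))))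
        (halves x y ∣xyT∣<1+j)
  where
  left-outside : ∀ x → blocksContaining (x ∷ outside ∷ T) (addApex (addIsolated D)) ≡ blocksContaining T D
  left-outside x =
    trans (blocksContaining-addApex x (outside ∷ T) (addIsolated D)) (blocksContaining-addIsolated-outside T D)
  left-inside : ∀ x → blocksContaining (x ∷ inside ∷ T) (addApex (addIsolated D)) ≡ 0
  left-inside x =
    trans (blocksContaining-addApex x (inside ∷ T) (addIsolated D)) (blocksContaining-addIsolated-inside T D)
  right-outside : ∀ y → blocksContaining (outside ∷ y ∷ T) (addIsolated (addApex D)) ≡ blocksContaining T D
  right-outside y =
    trans (blocksContaining-addIsolated-outside (y ∷ T) (addApex D)) (blocksContaining-addApex y T D)
  right-inside : ∀ y → blocksContaining (inside ∷ y ∷ T) (addIsolated (addApex D)) ≡ 0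
  right-inside y = blocksContaining-addIsolated-inside (y ∷ T) (addApex D)
  halves : ∀ x y → ∣ x ∷ y ∷ T ∣ < suc j →
    2 ∣ blocksContaining (x ∷ y ∷ T) (addApex (addIsolated D)) + blocksContaining (x ∷ y ∷ T) (addIsolated (addApex D))
  halves outside outside _ =
    subst (2 ∣_) (sym (cong₂ _+_ (left-outside outside) (right-outside outside))) (2∣m+m (blocksContaining T D))
  halves outside inside ∣T∣<j =
    subst (2 ∣_) (sym (cong₂ _+_ (left-inside outside) (right-outside inside))) (evenCover T (≤-pred ∣T∣<j))
  halves inside outside ∣T∣<j =
    subst (2 ∣_) (sym (trans (cong₂ _+_ (left-outside inside) (right-inside outside)) (+-identityʳ _)))
      (evenCover T (≤-pred ∣T∣<j))
  halves inside inside _ =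
    subst (2 ∣_) (sym (cong₂ _+_ (left-inside inside) (right-inside inside))) (2 ∣0)

pairUp-design : IsBinaryDesignBelow j n k D → IsBinaryDesignBelow (suc j) (suc (suc n)) (suc k) (pairUp D)
pairUp-design {D = D} isD = record
  { distinct  = Unique.++⁺ (distinct left) (distinct right) halves-disjoint
  ; blockSize = All.++⁺ (blockSize left) (blockSize right)
  ; evenCover = pairUp-evenCover {D = D} (evenCover isD)
  }
  where
  open IsBinaryDesignBelow
  left  = addApex-design (addIsolated-design isD)
  right = addIsolated-design (addApex-design isD)
  halves-disjoint : ∀ {v} → ¬ (v List.∈ addApex (addIsolated D) × v List.∈ addIsolated (addApex D))
  halves-disjoint (v∈left , v∈right) with _ , _ , refl ← ∈-map⁻ (inside ∷_) v∈left
                                      | _ , _ , () ← ∈-map⁻ (outside ∷_) v∈right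

length-pairUp : (D : List (Subset n)) → length (pairUp D) ≡ 2 * length D
length-pairUp D = begin
  length (pairUp D)                                       ≡⟨ length-++ (addApex (addIsolated D)) ⟩
  length (addApex (addIsolated D)) + length (addIsolated (addApex D))
    ≡⟨ cong₂ _+_ (trans (length-map _ (addIsolated D)) (length-map _ D))
                 (trans (length-map _ (addApex D)) (length-map _ D)) ⟩
  length D + length D                                     ≡⟨ cong (length D +_) (sym (+-identityʳ (length D))) ⟩
  2 * length D                                            ∎
  where open ≡-Reasoning

-- All 2^j ways of choosing one point from each of j disjoint pairs.
transversals : (j : ℕ) → List (Subset (j * 2))
transversals zero    = [] ∷ []
transversals (suc j) = pairUp (transversals j)

transversals-design : ∀ j → IsBinaryDesignBelow j (j * 2) j (transversals j)
transversals-design zero    = record { distinct = [] ∷ [] ; blockSize = refl ∷ [] ; evenCover = λ _ () }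
transversals-design (suc j) = pairUp-design (transversals-design j)

length-transversals : ∀ j → length (transversals j) ≡ 2 ^ j
length-transversals zero    = refl
length-transversals (suc j) = trans (length-pairUp (transversals j)) (cong (2 *_) (length-transversals j))

prefix : Subset m → List (Subset n) → List (Subset (m + n))
prefix []            D = D
prefix (inside  ∷ p) D = addApex (prefix p D)
prefix (outside ∷ p) D = addIsolated (prefix p D)

prefix-design : (p : Subset m) → IsBinaryDesignBelow j n k D → IsBinaryDesignBelow j (m + n) (∣ p ∣ + k) (prefix p D)
prefix-design []            isD = isD
prefix-design (inside  ∷ p) isD = addApex-design (prefix-design p isD)
prefix-design (outside ∷ p) isD = addIsolated-design (prefix-design p isD)

length-prefix : (p : Subset m) (D : List (Subset n)) → length (prefix p D) ≡ length D
length-prefix []            D = refl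
length-prefix (inside  ∷ p) D = trans (length-map _ (prefix p D)) (length-prefix p D)
length-prefix (outside ∷ p) D = trans (length-map _ (prefix p D)) (length-prefix p D)

toBinaryDesign : ∀ {t} → IsBinaryDesignBelow (suc t) n k D → D ≢ [] → IsBinaryDesign t n k D
toBinaryDesign isD D≢[] = record
  { nonempty  = D≢[]
  ; distinct  = distinct
  ; blockSize = blockSize
  ; evenCover = λ T ∣T∣≡t → evenCover T (s≤s (≤-reflexive ∣T∣≡t))
  }
  where open IsBinaryDesignBelow isD

-- Each block is a transversal of t + 1 pairs plus s fixed points; r further points lie in no block.
paddedTransversals : (t s r : ℕ) → List (Subset (r + (s + suc t * 2)))
paddedTransversals t s r = prefix (⊥ {r}) (prefix (⊤ {s}) (transversals (suc t)))

paddedTransversals-design : ∀ t s r →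
  IsBinaryDesign t (r + (s + suc t * 2)) (s + suc t) (paddedTransversals t s r) ×
  length (paddedTransversals t s r) ≡ 2 ^ (t + 1)
paddedTransversals-design t s r = toBinaryDesign isD nonempty , length≡
  where
  isD : IsBinaryDesignBelow (suc t) (r + (s + suc t * 2)) (s + suc t) (paddedTransversals t s r)
  isD = subst (λ k → IsBinaryDesignBelow (suc t) (r + (s + suc t * 2)) k (paddedTransversals t s r))
              (cong₂ (λ a b → a + (b + suc t)) (∣⊥∣≡0 r) (∣⊤∣≡n s))
              (prefix-design (⊥ {r}) (prefix-design (⊤ {s}) (transversals-design (suc t))))
  length≡ : length (paddedTransversals t s r) ≡ 2 ^ (t + 1)
  length≡ = begin
    length (paddedTransversals t s r)  ≡⟨ length-prefix (⊥ {r}) (prefix ⊤ (transversals (suc t))) ⟩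
    length (prefix (⊤ {s}) (transversals (suc t))) ≡⟨ length-prefix (⊤ {s}) (transversals (suc t)) ⟩
    length (transversals (suc t))      ≡⟨ length-transversals (suc t) ⟩
    2 ^ suc t                          ≡⟨ cong (2 ^_) (+-comm 1 t) ⟩
    2 ^ (t + 1)                        ∎
    where open ≡-Reasoning
  nonempty : paddedTransversals t s r ≢ []
  nonempty D≡[] with () ← m^n≡0⇒m≡0 2 (t + 1) (trans (sym length≡) (cong length D≡[]))

design-size-upper : ∀ {t} → t < k → k + t + 1 ≤ n →
  ∃ λ D → IsBinaryDesign t n k D × length D ≤ 2 ^ (t + 1)
design-size-upper {t = t} t<k k+t+1≤n with s , refl ← m≤n⇒∃[o]m+o≡n t<k
  with r , refl ← m≤n⇒∃[o]m+o≡n k+t+1≤n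
  with isD , length≡ ← paddedTransversals-design t s r
  = subst₂ (λ n k → ∃ λ D → IsBinaryDesign t n k D × length D ≤ 2 ^ (t + 1))
           (ground-size t s r) (+-comm s (suc t))
           (paddedTransversals t s r , isD , ≤-reflexive length≡)
  where
  ground-size : ∀ t s r → r + (s + suc t * 2) ≡ suc t + s + t + 1 + r
  ground-size = solve-∀

corollary1 : (t n k : ℕ) → t < k → k + t + 1 ≤ n →
    MinDesignSizeBetween t n k (t + 2) (2 ^ (t + 1))
corollary1 t n k t<k k+t+1≤n = (λ D → design-size-lower t<k) , design-size-upper t<k k+t+1≤n
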